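{- Let $\mathcal{C}$ be a gs-monoidal category with objects $T,C$ and a behavior structure $(\Phi,\overline B,\overline{\mathrm{eval}},\succeq)$, and let $\succeq$ also denote the corresponding ambient imitation relation. Then for all $f,g\colon A\to T\otimes C$, if $f\sqsupseteq g$ then $f\succeq g$.
   Context: A gs-monoidal category is a symmetric monoidal category (tensor $\otimes$, unit $I$) whose objects carry commutative comonoids $\mathrm{copy}_A\colon A\to A\otimes A$, $\mathrm{del}_A\colon A\to I$ compatible with $\otimes$, $\mathrm{del}_I=\mathrm{id}_I$. For $f\colon A\to X$, $\mathrm{dom}(f):=(\mathrm{id}_A\otimes(\mathrm{del}_X\circ f))\circ\mathrm{copy}_A$, and for $f,g\colon A\to X$, $f\sqsupseteq g$ means $f\circ\mathrm{dom}(g)=g$. $\mathbf{Rel}$ is the category of sets and relations with cartesian product. A lax gs-monoidal functor $\Phi\colon\mathcal{C}\to\mathbf{Rel}$ is a lax symmetric monoidal functor whose structure maps $\psi_0,\psi_{A,B}$ satisfy $\Phi(\mathrm{copy}_A)=\psi_{A,A}\circ\mathrm{copy}_{\Phi A}$, $\Phi(\mathrm{del}_A)=\psi_0\circ\mathrm{del}_{\Phi A}$; write $\overline X=\Phi(X)$, $\overline f=\Phi(f)$. A behavior structure $(\Phi,\overline B,\overline{\mathrm{eval}},\succeq)$: a lax gs-monoidal $\Phi\colon\mathcal{C}\to\mathbf{Rel}$, a set $\overline B$, a function $\overline{\mathrm{eval}}\colon\overline{T\otimes C}\to\overline B$, a preorder $\succeq$ on $\overline B$. Imitation: for relations $\nu,\mu\colon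 A\to\overline B$, $\nu\succeq^{\rm im}\mu$ iff for every $a$ with $\mu(a)\ne\emptyset$ there are functions $\mathrm{enh}\colon\mu(a)\to\nu(a)$ with $\mathrm{enh}(u)\succeq u$ and $\mathrm{deg}\colon\nu(a)\to\mu(a)$ with $v\succeq\mathrm{deg}(v)$. Ambient imitation relation: $f\succeq g$ iff $\overline{\mathrm{eval}}\circ\overline f\succeq^{\rm im}\overline{\mathrm{eval}}\circ\overline g$. -}

module Defs where

open import Level using (Level; _⊔_; suc)
open import Data.Product using (Σ; _×_; _,_; proj₁; proj₂)
open import Data.Unit.Polymorphic using (⊤; tt)
open import Relation.Binary.PropositionalEquality using (_≡_)
open import Relation.Binary.Structures using (IsEquivalence; IsPreorder)

Rel : ∀ {r} → Set r → Set r → Set (suc r)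
Rel {r} X Y = X → Y → Set r

_⊙_ : ∀ {r} {X Y Z : Set r} → Rel Y Z → Rel X Y → Rel X Z
(S ⊙ R) x z = Σ _ λ y → R x y × S y z
infixr 9 _⊙_

_≐_ : ∀ {r} {X Y : Set r} → Rel X Y → Rel X Y → Set r
R ≐ S = ∀ x y → (R x y → S x y) × (S x y → R x y)
infix 4 _≐_

idRel : ∀ {r} {X : Set r} → Rel X X
idRel x y = x ≡ y

graph : ∀ {r} {X Y : Set r} → (X → Y) → Rel X Y
graph f x y = f x ≡ y

_×R_ : ∀ {r} {X X' Y Y' : Set r} → Rel X X' → Rel Y Y' → Rel (X × Y) (X' × Y')
(R ×R S) (x , y) (x' , y') = R x x' × S y y'

record GSMonoidalCategory (o ℓ e : Level) : Set (suc (o ⊔ ℓ ⊔ e)) where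
  infixr 9 _∘_
  infixr 10 _⊗₀_ _⊗₁_
  infix 4 _≈_
  field
    Obj : Set o
    Hom : Obj → Obj → Set ℓ
    _≈_ : ∀ {A B} → Hom A B → Hom A B → Set e
    ≈-equiv : ∀ {A B} → IsEquivalence (_≈_ {A} {B})
    id  : ∀ {A} → Hom A A
    _∘_ : ∀ {A B C} → Hom B C → Hom A B → Hom A C
    ∘-resp-≈ : ∀ {A B C} {f f' : Hom B C} {g g' : Hom A B} →
               f ≈ f' → g ≈ g' → f ∘ g ≈ f' ∘ g'
    assoc : ∀ {A B C D} {f : Hom A B} {g : Hom B C} {h : Hom C D} →
            (h ∘ g) ∘ f ≈ h ∘ (g ∘ f)
    identityˡ : ∀ {A B} {f : Hom A B} → id ∘ f ≈ f
    identityʳ : ∀ {A B} {f : Hom A B} → f ∘ id ≈ f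

    _⊗₀_ : Obj → Obj → Obj
    unit : Obj
    _⊗₁_ : ∀ {A B C D} → Hom A B → Hom C D → Hom (A ⊗₀ C) (B ⊗₀ D)
    ⊗-resp-≈ : ∀ {A B C D} {f f' : Hom A B} {g g' : Hom C D} →
               f ≈ f' → g ≈ g' → f ⊗₁ g ≈ f' ⊗₁ g'
    ⊗-identity : ∀ {A B} → id {A} ⊗₁ id {B} ≈ id
    ⊗-homomorphism : ∀ {A B C D E F} {f : Hom A B} {g : Hom B C}
                       {h : Hom D E} {k : Hom E F} →
                     (g ∘ f) ⊗₁ (k ∘ h) ≈ (g ⊗₁ k) ∘ (f ⊗₁ h)
    α  : ∀ {A B C} → Hom ((A ⊗₀ B) ⊗₀ C) (A ⊗₀ (B ⊗₀ C))
    α⁻¹ : ∀ {A B C} → Hom (A ⊗₀ (B ⊗₀ C)) ((A ⊗₀ B) ⊗₀ C)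
    λ⇒ : ∀ {A} → Hom (unit ⊗₀ A) A
    λ⇐ : ∀ {A} → Hom A (unit ⊗₀ A)
    ρ⇒ : ∀ {A} → Hom (A ⊗₀ unit) A
    ρ⇐ : ∀ {A} → Hom A (A ⊗₀ unit)
    α-iso₁ : ∀ {A B C} → α {A} {B} {C} ∘ α⁻¹ ≈ id
    α-iso₂ : ∀ {A B C} → α⁻¹ ∘ α {A} {B} {C} ≈ id
    λ-iso₁ : ∀ {A} → λ⇒ {A} ∘ λ⇐ ≈ id
    λ-iso₂ : ∀ {A} → λ⇐ ∘ λ⇒ {A} ≈ id
    ρ-iso₁ : ∀ {A} → ρ⇒ {A} ∘ ρ⇐ ≈ id
    ρ-iso₂ : ∀ {A} → ρ⇐ ∘ ρ⇒ {A} ≈ id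
    α-natural : ∀ {A A' B B' C C'} {f : Hom A A'} {g : Hom B B'} {h : Hom C C'} →
                α ∘ ((f ⊗₁ g) ⊗₁ h) ≈ (f ⊗₁ (g ⊗₁ h)) ∘ α
    λ-natural : ∀ {A B} {f : Hom A B} → λ⇒ ∘ (id ⊗₁ f) ≈ f ∘ λ⇒
    ρ-natural : ∀ {A B} {f : Hom A B} → ρ⇒ ∘ (f ⊗₁ id) ≈ f ∘ ρ⇒
    pentagon : ∀ {A B C D} →
               (id {A} ⊗₁ α {B} {C} {D}) ∘ α ∘ (α ⊗₁ id) ≈ α ∘ α
    triangle : ∀ {A B} → (id {A} ⊗₁ λ⇒ {B}) ∘ α ≈ ρ⇒ ⊗₁ id

    σ : ∀ {A B} → Hom (A ⊗₀ B) (B ⊗₀ A)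
    σ-natural : ∀ {A A' B B'} {f : Hom A A'} {g : Hom B B'} →
                σ ∘ (f ⊗₁ g) ≈ (g ⊗₁ f) ∘ σ
    σ-involutive : ∀ {A B} → σ {B} {A} ∘ σ {A} {B} ≈ id
    hexagon : ∀ {A B C} →
              α {B} {C} {A} ∘ σ {A} {B ⊗₀ C} ∘ α ≈ (id ⊗₁ σ) ∘ α ∘ (σ ⊗₁ id)

    -- gs-structure: commutative comonoids, not required to be natural
    copy : ∀ {A} → Hom A (A ⊗₀ A)
    del  : ∀ {A} → Hom A unit
    copy-coassoc : ∀ {A} → α ∘ (copy ⊗₁ id) ∘ copy {A} ≈ (id ⊗₁ copy) ∘ copy
    copy-counitˡ : ∀ {A} → λ⇒ ∘ (del ⊗₁ id) ∘ copy {A} ≈ id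
    copy-counitʳ : ∀ {A} → ρ⇒ ∘ (id ⊗₁ del) ∘ copy {A} ≈ id
    copy-comm : ∀ {A} → σ ∘ copy {A} ≈ copy
    copy-⊗ : ∀ {A B} →
             copy {A ⊗₀ B} ≈
             (α⁻¹ ∘ (id ⊗₁ (α ∘ (σ ⊗₁ id) ∘ α⁻¹)) ∘ α) ∘ (copy {A} ⊗₁ copy {B})
    del-⊗ : ∀ {A B} → del {A ⊗₀ B} ≈ λ⇒ ∘ (del {A} ⊗₁ del {B})
    del-unit : del {unit} ≈ id

  dom : ∀ {A X} → Hom A X → Hom A A
  dom f = ρ⇒ ∘ (id ⊗₁ (del ∘ f)) ∘ copy

  _⊒_ : ∀ {A X} → Hom A X → Hom A X → Set e
  f ⊒ g = f ∘ dom g ≈ g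

record LaxGSFunctor {o ℓ e} (𝒞 : GSMonoidalCategory o ℓ e) (r : Level)
       : Set (o ⊔ ℓ ⊔ e ⊔ suc r) where
  open GSMonoidalCategory 𝒞
  field
    F₀ : Obj → Set r
    F₁ : ∀ {A B} → Hom A B → Rel (F₀ A) (F₀ B)
    F-identity : ∀ {A} → F₁ (id {A}) ≐ idRel
    F-homomorphism : ∀ {A B C} {f : Hom A B} {g : Hom B C} →
                     F₁ (g ∘ f) ≐ F₁ g ⊙ F₁ f
    F-resp-≈ : ∀ {A B} {f g : Hom A B} → f ≈ g → F₁ f ≐ F₁ g
    ψ₀ : Rel ⊤ (F₀ unit)
    ψ  : ∀ {A B} → Rel (F₀ A × F₀ B) (F₀ (A ⊗₀ B))
    ψ-natural : ∀ {A A' B B'} {f : Hom A A'} {g : Hom B B'} →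
                F₁ (f ⊗₁ g) ⊙ ψ ≐ ψ ⊙ (F₁ f ×R F₁ g)
    ψ-assoc : ∀ {A B C} →
              F₁ (α {A} {B} {C}) ⊙ ψ ⊙ (ψ ×R idRel) ≐
              ψ ⊙ (idRel ×R ψ) ⊙ graph (λ { ((a , b) , c) → a , (b , c) })
    ψ-unitˡ : ∀ {A} → F₁ (λ⇒ {A}) ⊙ ψ ⊙ (ψ₀ ×R idRel) ≐ graph proj₂
    ψ-unitʳ : ∀ {A} → F₁ (ρ⇒ {A}) ⊙ ψ ⊙ (idRel ×R ψ₀) ≐ graph proj₁
    ψ-symmetric : ∀ {A B} →
                  F₁ (σ {A} {B}) ⊙ ψ ≐ ψ ⊙ graph (λ { (a , b) → b , a })
    F-copy : ∀ {A} → F₁ (copy {A}) ≐ ψ ⊙ graph (λ x → x , x)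
    F-del  : ∀ {A} → F₁ (del {A}) ≐ ψ₀ ⊙ graph (λ _ → tt)

record BehaviorStructure {o ℓ e} (𝒞 : GSMonoidalCategory o ℓ e)
       (T C : GSMonoidalCategory.Obj 𝒞) (r : Level)
       : Set (o ⊔ ℓ ⊔ e ⊔ suc r) where
  open GSMonoidalCategory 𝒞
  field
    Φ : LaxGSFunctor 𝒞 r
  open LaxGSFunctor Φ
  field
    B̄ : Set r
    eval : F₀ (T ⊗₀ C) → B̄
    _≽_ : B̄ → B̄ → Set r
    ≽-isPreorder : IsPreorder _≡_ _≽_

  _≽ᵢₘ_ : ∀ {X : Set r} → Rel X B̄ → Rel X B̄ → Set r
  ν ≽ᵢₘ μ = ∀ x → Σ B̄ (μ x) →
            Σ (Σ B̄ (μ x) → Σ B̄ (ν x)) (λ enh → ∀ u → proj₁ (enh u) ≽ proj₁ u)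
          × Σ (Σ B̄ (ν x) → Σ B̄ (μ x)) (λ deg → ∀ v → proj₁ v ≽ proj₁ (deg v))

  _≽ₐ_ : ∀ {A} → Hom A (T ⊗₀ C) → Hom A (T ⊗₀ C) → Set r
  f ≽ₐ g = (graph eval ⊙ F₁ f) ≽ᵢₘ (graph eval ⊙ F₁ g)

{-# OPTIONS --safe #-}
module Submission where

-- Under the lax gs-monoidal functor, dom g becomes the partial identity on the
-- points where the relation of g is defined.  So if f ∘ dom g = g, the relations
-- of f and g coincide at every point where that of g is defined, which is exactly
-- where imitation asks for something; there enhancement and degradation can both
-- be the identity, witnessed by reflexivity of the preorder.

open import Defs
open import Data.Product using (Σ; _×_; _,_; proj₁; proj₂)
open import Data.Unit.Polymorphic using (tt)
open import Function.Bundles using (_⇔_; mk⇔; Equivalence)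
open import Relation.Binary.PropositionalEquality using (_≡_; refl)
open import Relation.Binary.Structures using (IsPreorder)

open Equivalence using (to; from)

⊙-congʳ-at : ∀ {r} {X Y Z : Set r} {Q : Rel Y Z} {R S : Rel X Y} {x : X} →
             (∀ y → R x y ⇔ S x y) → ∀ z → (Q ⊙ R) x z ⇔ (Q ⊙ S) x z
⊙-congʳ-at R⇔S z = mk⇔ (λ (y , r , q) → y , to (R⇔S y) r , q)
                       (λ (y , s , q) → y , from (R⇔S y) s , q)

module _ {o ℓ e r} {𝒞 : GSMonoidalCategory o ℓ e} (Φ : LaxGSFunctor 𝒞 r) where
  open GSMonoidalCategory 𝒞
  open LaxGSFunctor Φ

  F-del∘ : ∀ {A B} {h : Hom A B} {x q} →
           F₁ (del ∘ h) x q ⇔ (Σ _ (F₁ h x) × ψ₀ tt q)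
  F-del∘ {h = h} {x} {q} = mk⇔ to′ from′
    where
    to′ : F₁ (del ∘ h) x q → Σ _ (F₁ h x) × ψ₀ tt q
    to′ d with proj₁ (F-homomorphism x q) d
    ... | y , hy , dy with proj₁ (F-del y q) dy
    ... | _ , refl , ψ₀q = (y , hy) , ψ₀q

    from′ : Σ _ (F₁ h x) × ψ₀ tt q → F₁ (del ∘ h) x q
    from′ ((y , hy) , ψ₀q) =
      proj₂ (F-homomorphism x q) (y , hy , proj₂ (F-del y q) (tt , refl , ψ₀q))

  F-⟨id,_⟩ : ∀ {A B} (h : Hom A B) {x w} →
             F₁ ((id ⊗₁ h) ∘ copy) x w ⇔ Σ _ λ q → F₁ h x q × ψ (x , q) w
  F-⟨id, h ⟩ {x} {w} = mk⇔ to′ from′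
    where
    to′ : F₁ ((id ⊗₁ h) ∘ copy) x w → Σ _ λ q → F₁ h x q × ψ (x , q) w
    to′ k with proj₁ (F-homomorphism x w) k
    ... | z , cz , kz with proj₁ (F-copy x z) cz
    ... | _ , refl , ψxx with proj₁ (ψ-natural (x , x) w) (z , ψxx , kz)
    ... | (p , q) , (idp , hq) , ψpq with proj₁ (F-identity x p) idp
    ... | refl = q , hq , ψpq

    from′ : (Σ _ λ q → F₁ h x q × ψ (x , q) w) → F₁ ((id ⊗₁ h) ∘ copy) x w
    from′ (q , hq , ψxq) =
      let idx = proj₂ (F-identity x x) refl
          z , ψxx , kz = proj₂ (ψ-natural (x , x) w) ((x , q) , (idx , hq) , ψxq)
      in proj₂ (F-homomorphism x w) (z , proj₂ (F-copy x z) (_ , refl , ψxx) , kz)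

  F-dom : ∀ {A X} {g : Hom A X} {x x'} →
          F₁ (dom g) x x' ⇔ (x ≡ x' × Σ _ (F₁ g x))
  F-dom {g = g} {x} {x'} = mk⇔ to′ from′
    where
    to′ : F₁ (dom g) x x' → x ≡ x' × Σ _ (F₁ g x)
    to′ d with proj₁ (F-homomorphism x x') d
    ... | w , k , ρw with to F-⟨id, del ∘ g ⟩ k
    ... | q , dq , ψxq with to F-del∘ dq
    ... | gx , ψ₀q =
      proj₁ (ψ-unitʳ (x , tt) x') (w , ((x , q) , (refl , ψ₀q) , ψxq) , ρw) , gx

    from′ : x ≡ x' × Σ _ (F₁ g x) → F₁ (dom g) x x'
    from′ (refl , gx) with proj₂ (ψ-unitʳ (x , tt) x) refl
    ... | w , ((_ , q) , (refl , ψ₀q) , ψxq) , ρw =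
      proj₂ (F-homomorphism x x)
        (w , from F-⟨id, del ∘ g ⟩ (q , from F-del∘ (gx , ψ₀q) , ψxq) , ρw)

  ⊒⇒F-agree : ∀ {A X} {f g : Hom A X} → f ⊒ g →
              ∀ {x} → Σ _ (F₁ g x) → ∀ y → F₁ f x y ⇔ F₁ g x y
  ⊒⇒F-agree {f = f} {g} f⊒g {x} gx y = mk⇔ to′ from′
    where
    to′ : F₁ f x y → F₁ g x y
    to′ fy = proj₁ (F-resp-≈ f⊒g x y)
               (proj₂ (F-homomorphism x y) (x , from F-dom (refl , gx) , fy))

    from′ : F₁ g x y → F₁ f x y
    from′ gy with proj₁ (F-homomorphism x y) (proj₂ (F-resp-≈ f⊒g x y) gy)
    ... | x' , d , fy with to F-dom d
    ... | refl , _ = fy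

module _ {o ℓ e r} {𝒞 : GSMonoidalCategory o ℓ e} {T C : GSMonoidalCategory.Obj 𝒞}
         (β : BehaviorStructure 𝒞 T C r) where
  open BehaviorStructure β

  ⇔-on-defined⇒≽ᵢₘ : ∀ {X : Set r} {ν μ : Rel X B̄} →
                      (∀ x → Σ B̄ (μ x) → ∀ b → ν x b ⇔ μ x b) → ν ≽ᵢₘ μ
  ⇔-on-defined⇒≽ᵢₘ ν⇔μ x μx =
      ((λ (b , μb) → b , from (ν⇔μ x μx b) μb) , λ _ → ≽-refl)
    , ((λ (b , νb) → b , to (ν⇔μ x μx b) νb) , λ _ → ≽-refl)
    where ≽-refl = IsPreorder.refl ≽-isPreorder

mainTheorem15 : ∀ {o ℓ e r} (𝒞 : GSMonoidalCategory o ℓ e)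
    (T C : GSMonoidalCategory.Obj 𝒞) (β : BehaviorStructure 𝒞 T C r)
    {A : GSMonoidalCategory.Obj 𝒞}
    (f g : GSMonoidalCategory.Hom 𝒞 A (GSMonoidalCategory._⊗₀_ 𝒞 T C)) →
    GSMonoidalCategory._⊒_ 𝒞 f g → BehaviorStructure._≽ₐ_ β f g
mainTheorem15 𝒞 T C β f g f⊒g =
  ⇔-on-defined⇒≽ᵢₘ β λ x (_ , y , gy , _) →
    ⊙-congʳ-at {R = F₁ f} {S = F₁ g} (⊒⇒F-agree Φ f⊒g (y , gy))
  where open BehaviorStructure β using (Φ)
        open LaxGSFunctor Φ using (F₁)
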